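{- Let $M$ be a model of the theory $T$ described below, let $A \subseteq B \subseteq M$, and let $p \in S(A)$ be a non-algebraic type. Then $p$ has a unique extension to a non-algebraic type $q \in S(B)$.
   Context: $L$ has a unary predicate $U_\sigma$ for every $\sigma\in\omega^{<\omega}$ and a binary relation $B_{\sigma,\tau}$ for every pair $\sigma,\tau\in\omega^{<\omega}$ of the same length. $T$ consists of: (a) $U_\emptyset$ is the whole universe; (b) $U_\sigma \neq \emptyset$; (c) $U_\sigma \supset U_\tau$ whenever $\sigma$ is an initial segment of $\tau$; (d) $U_{\sigma i} \cap U_{\sigma j} = \emptyset$ for distinct numbers $i,j$; (e) $B_{\sigma,\tau}$ is the graph of a bijection from $U_\sigma$ to $U_\tau$; (f) $B_{\sigma,\tau}(x,y)\leftrightarrow B_{\tau,\sigma}(y,x)$; (g) $B_{\sigma,\tau}(x,y)\wedge B_{\tau,\rho}(y,z) \to B_{\sigma,\rho}(x,z)$; (h) if $U_{\sigma i}(x)$ and $U_\tau(y)$ then $B_{\sigma,\tau}(x,y)$ iff $U_{\tau i}(y)$ and $B_{\sigma i,\tau i}(x,y)$ (all strings indexing a $B$ having equal length). -}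

module Defs where

open import Level using (0ℓ)
open import Data.Nat using (ℕ; suc)
open import Data.Fin using (Fin; zero; suc)
open import Data.Vec using (Vec; []; _++_; _∷ʳ_)
open import Data.List using (List)
open import Data.List.Relation.Unary.All using (All)
open import Data.List.Membership.Propositional using (_∈_)
open import Data.Product using (Σ; ∃; _×_; _,_; proj₁)
open import Data.Sum using (_⊎_)
open import Data.Empty using (⊥)
open import Relation.Nullary using (¬_)
open import Relation.Binary.PropositionalEquality using (_≡_; _≢_)

-- The language L.  Strings σ ∈ ω^{<ω} of length n are 'Vec ℕ n';
-- σi is 'σ ∷ʳ i'.  B_{σ,τ} exists only for σ, τ of the same length,
-- which is built into the indexing.

record L-Structure : Set₁ where
  field
    Carrier : Set
    U : ∀ {n} → Vec ℕ n → Carrier → Set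
    B : ∀ {n} → Vec ℕ n → Vec ℕ n → Carrier → Carrier → Set

-- The axioms (a)–(h) of T, read semantically in a structure
-- (equality of L is interpreted as propositional equality).
record IsModelOfT (M : L-Structure) : Set where
  open L-Structure M
  field
    ax-a : ∀ x → U [] x
    ax-b : ∀ {n} (σ : Vec ℕ n) → ∃ λ x → U σ x
    ax-c : ∀ {m k} (σ : Vec ℕ m) (ρ : Vec ℕ k) x → U (σ ++ ρ) x → U σ x
    ax-d : ∀ {n} (σ : Vec ℕ n) (i j : ℕ) → i ≢ j → ∀ x →
           U (σ ∷ʳ i) x → U (σ ∷ʳ j) x → ⊥
    ax-e-dom : ∀ {n} (σ τ : Vec ℕ n) x y → B σ τ x y → U σ x × U τ y
    ax-e-tot : ∀ {n} (σ τ : Vec ℕ n) x → U σ x → ∃ λ y → B σ τ x y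
    ax-e-fun : ∀ {n} (σ τ : Vec ℕ n) x y y' → B σ τ x y → B σ τ x y' → y ≡ y'
    ax-e-inj : ∀ {n} (σ τ : Vec ℕ n) x x' y → B σ τ x y → B σ τ x' y → x ≡ x'
    ax-e-sur : ∀ {n} (σ τ : Vec ℕ n) y → U τ y → ∃ λ x → B σ τ x y
    ax-f₁ : ∀ {n} (σ τ : Vec ℕ n) x y → B σ τ x y → B τ σ y x
    ax-f₂ : ∀ {n} (σ τ : Vec ℕ n) x y → B τ σ y x → B σ τ x y
    ax-g : ∀ {n} (σ τ ρ : Vec ℕ n) x y z → B σ τ x y → B τ ρ y z → B σ ρ x z
    ax-h₁ : ∀ {n} (σ τ : Vec ℕ n) (i : ℕ) x y → U (σ ∷ʳ i) x → U τ y →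
            B σ τ x y → U (τ ∷ʳ i) y × B (σ ∷ʳ i) (τ ∷ʳ i) x y
    ax-h₂ : ∀ {n} (σ τ : Vec ℕ n) (i : ℕ) x y → U (σ ∷ʳ i) x → U τ y →
            U (τ ∷ʳ i) y × B (σ ∷ʳ i) (τ ∷ʳ i) x y → B σ τ x y

-- First-order L-formulas with equality, parameters from P and free
-- variables Fin n (de Bruijn).  Connectives ¬, ∧, ∃ (others are
-- definable).

data Term (P : Set) (n : ℕ) : Set where
  var : Fin n → Term P n
  par : P → Term P n

data Formula (P : Set) : ℕ → Set where
  _≐_  : ∀ {n} → Term P n → Term P n → Formula P n
  Uₐ   : ∀ {n k} → Vec ℕ k → Term P n → Formula P n
  Bₐ   : ∀ {n k} → Vec ℕ k → Vec ℕ k → Term P n → Term P n → Formula P n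
  ¬ᶠ_  : ∀ {n} → Formula P n → Formula P n
  _∧ᶠ_ : ∀ {n} → Formula P n → Formula P n → Formula P n
  ∃ᶠ   : ∀ {n} → Formula P (suc n) → Formula P n

mapTerm : ∀ {P Q n} → (P → Q) → Term P n → Term Q n
mapTerm f (var i) = var i
mapTerm f (par a) = par (f a)

mapFormula : ∀ {P Q n} → (P → Q) → Formula P n → Formula Q n
mapFormula f (s ≐ t) = mapTerm f s ≐ mapTerm f t
mapFormula f (Uₐ σ t) = Uₐ σ (mapTerm f t)
mapFormula f (Bₐ σ τ s t) = Bₐ σ τ (mapTerm f s) (mapTerm f t)
mapFormula f (¬ᶠ φ) = ¬ᶠ mapFormula f φ
mapFormula f (φ ∧ᶠ ψ) = mapFormula f φ ∧ᶠ mapFormula f ψ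
mapFormula f (∃ᶠ φ) = ∃ᶠ (mapFormula f φ)

module Semantics (M : L-Structure) where
  open L-Structure M

  Params : (Carrier → Set) → Set
  Params A = Σ Carrier A

  extend : ∀ {n} → Carrier → (Fin n → Carrier) → Fin (suc n) → Carrier
  extend a ρ zero = a
  extend a ρ (suc i) = ρ i

  evalT : ∀ {A : Carrier → Set} {n} → (Fin n → Carrier) → Term (Params A) n → Carrier
  evalT ρ (var i) = ρ i
  evalT ρ (par a) = proj₁ a

  Sat : ∀ {A : Carrier → Set} {n} → Formula (Params A) n → (Fin n → Carrier) → Set
  Sat (s ≐ t) ρ = evalT ρ s ≡ evalT ρ t
  Sat (Uₐ σ t) ρ = U σ (evalT ρ t)
  Sat (Bₐ σ τ s t) ρ = B σ τ (evalT ρ s) (evalT ρ t)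
  Sat (¬ᶠ φ) ρ = ¬ Sat φ ρ
  Sat (φ ∧ᶠ ψ) ρ = Sat φ ρ × Sat ψ ρ
  Sat (∃ᶠ φ) ρ = ∃ λ a → Sat φ (extend a ρ)

  _⊨_ : ∀ {A : Carrier → Set} → Carrier → Formula (Params A) 1 → Set
  a ⊨ φ = Sat φ (λ _ → a)

  TypeOver : (Carrier → Set) → Set₁
  TypeOver A = Formula (Params A) 1 → Set

  -- p ∈ S(A): p is consistent with Th(M_A) (equivalently, by
  -- compactness, finitely satisfiable in M) and complete.
  IsCompleteType : (A : Carrier → Set) → TypeOver A → Set
  IsCompleteType A p =
    (∀ (φs : List (Formula (Params A) 1)) → All p φs →
       ∃ λ a → All (λ φ → a ⊨ φ) φs)
    × (∀ φ → p φ ⊎ p (¬ᶠ φ))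

  FiniteSolutions : ∀ {A : Carrier → Set} → Formula (Params A) 1 → Set
  FiniteSolutions φ = ∃ λ (xs : List Carrier) → ∀ a → a ⊨ φ → a ∈ xs

  IsAlgebraic : ∀ {A : Carrier → Set} → TypeOver A → Set
  IsAlgebraic {A} p = ∃ λ (φ : Formula (Params A) 1) → p φ × FiniteSolutions φ

  NonAlgebraic : ∀ {A : Carrier → Set} → TypeOver A → Set
  NonAlgebraic p = ¬ IsAlgebraic p

  Extends : ∀ {A B : Carrier → Set} → (∀ x → A x → B x) →
            TypeOver A → TypeOver B → Set
  Extends A⊆B p q = ∀ φ → p φ → q (mapFormula (λ { (a , h) → a , A⊆B a h }) φ)

  SameType : ∀ {B : Carrier → Set} → TypeOver B → TypeOver B → Set
  SameType q q' = ∀ φ → (q φ → q' φ) × (q' φ → q φ)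

module Submission where

-- Call a formula N-bounded if every string in it has length and entries
-- below N, and call c ∈ U_β N-generic if c lies in no U_{βj} with j < N.
-- For two distinct N-generic elements c, c' of U_β, the map exchanging the
-- B-orbits of c and c' (the images of c, c' under the bijections B_{β,τ})
-- and fixing every other point preserves all N-bounded atomic formulas, so
-- c and c' satisfy the same N-bounded formulas over any parameters outside
-- their orbits.  Descending along p as far as N allows gives a node β such
-- that p forces its realisations to be N-generic elements of U_β; hence the
-- formulas φ holding at all realisations of some finite part of p outside
-- some finite set form a complete type q.  It is non-algebraic because p
-- is, and every non-algebraic extension q' of p contains q, since otherwise
-- q' would contain a formula all of whose realisations lie in a finite set.

open import Defs
open import Level using (0ℓ)
open import Axiom.ExcludedMiddle using (ExcludedMiddle)
open import Data.Product using (∃; _×_; Σ; _,_; proj₁; proj₂)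
open import Data.Nat using (ℕ; zero; suc; _≤_; _<_; z≤n; s≤s; _⊔_; _+_; _≟_; _≤?_)
open import Data.Nat.Properties
open import Data.Fin using () renaming (zero to fz; suc to fs)
open import Data.Vec as V using (Vec; []; _∷_; _∷ʳ_; toList; fromList)
open import Data.Vec.Properties
  using (toList-injective; cast-is-id; toList-++; toList-∷ʳ; toList∘fromList; length-toList)
open import Data.List as L using (List)
import Data.List.Properties as LP
open import Data.List.Relation.Unary.All as All using (All)
import Data.List.Relation.Unary.All.Properties as AllP
open import Data.List.Relation.Unary.Any using (here)
open import Data.List.Membership.Propositional using (_∈_; lose)
open import Data.List.Membership.Propositional.Properties
  using (∈-++⁺ˡ; ∈-++⁺ʳ; ∈-concatMap⁺; ∈-upTo⁺; ∈-upTo⁻)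
open import Data.Sum using (_⊎_; inj₁; inj₂)
open import Data.Empty using (⊥; ⊥-elim)
open import Data.Unit using (⊤; tt)
open import Relation.Nullary using (¬_; Dec; yes; no)
open import Relation.Binary.PropositionalEquality

-- Strings of different lengths are compared through their lists of entries.

toList-length : ∀ {m n} (σ : Vec ℕ m) (τ : Vec ℕ n) → toList σ ≡ toList τ → m ≡ n
toList-length σ τ e = trans (sym (length-toList σ)) (trans (cong L.length e) (length-toList τ))

toList-injective′ : ∀ {n} (σ τ : Vec ℕ n) → toList σ ≡ toList τ → σ ≡ τ
toList-injective′ σ τ e = trans (sym (cast-is-id refl σ)) (toList-injective refl σ τ e)

fromList-ofLength : ∀ {n} (l : List ℕ) → L.length l ≡ n → Σ (Vec ℕ n) λ v → toList v ≡ l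
fromList-ofLength l refl = fromList l , toList∘fromList l

toList-++-fromList : ∀ {m} (σ : Vec ℕ m) (γ : List ℕ) →
                     toList (σ V.++ fromList γ) ≡ toList σ L.++ γ
toList-++-fromList σ γ = trans (toList-++ σ (fromList γ)) (cong (toList σ L.++_) (toList∘fromList γ))

toList-∷ʳ-++ : ∀ {m} (σ : Vec ℕ m) (j : ℕ) (γ : List ℕ) →
               toList σ L.++ (j L.∷ γ) ≡ toList (σ ∷ʳ j) L.++ γ
toList-∷ʳ-++ σ j γ = begin
  toList σ L.++ (j L.∷ γ)           ≡⟨ LP.++-assoc (toList σ) L.[ j ] γ ⟨
  (toList σ L.++ L.[ j ]) L.++ γ    ≡⟨ cong (L._++ γ) (toList-∷ʳ j σ) ⟨
  toList (σ ∷ʳ j) L.++ γ            ∎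
  where open ≡-Reasoning

splitPrefix : ∀ {m n} → m ≤ n → (τ : Vec ℕ n) →
              Σ (Vec ℕ m) λ σ → Σ (List ℕ) λ γ → toList τ ≡ toList σ L.++ γ
splitPrefix z≤n τ = [] , toList τ , refl
splitPrefix (s≤s m≤n) (t ∷ τ) with splitPrefix m≤n τ
... | σ , γ , e = t ∷ σ , γ , cong (t L.∷_) e

SameTail : ∀ {k ℓ} (σ ρ : Vec ℕ k) (τ υ : Vec ℕ ℓ) → Set
SameTail σ ρ τ υ = Σ (List ℕ) λ γ → toList τ ≡ toList σ L.++ γ × toList υ ≡ toList ρ L.++ γ

Bounded : ℕ → ∀ {k} → Vec ℕ k → Set
Bounded N {k} σ = k ≤ N × All (_< N) (toList σ)

Bounded-mono : ∀ {N N' k} {σ : Vec ℕ k} → N ≤ N' → Bounded N σ → Bounded N' σ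
Bounded-mono N≤N' (k≤N , σ<N) = ≤-trans k≤N N≤N' , All.map (λ i<N → <-≤-trans i<N N≤N') σ<N

bounded-exists : ∀ {k} (σ : Vec ℕ k) → ∃ λ N → Bounded N σ
bounded-exists [] = 0 , z≤n , All.[]
bounded-exists (i ∷ σ) with bounded-exists σ
... | N , k≤N , σ<N =
  suc (i ⊔ N) ,
  s≤s (≤-trans k≤N (m≤n⊔m i N)) ,
  s≤s (m≤m⊔n i N) All.∷ All.map (λ j<N → <-≤-trans j<N (≤-trans (m≤n⊔m i N) (n≤1+n _))) σ<N

BoundedFormula : ∀ {P n} → ℕ → Formula P n → Set
BoundedFormula N (s ≐ t) = ⊤
BoundedFormula N (Uₐ σ t) = Bounded N σ
BoundedFormula N (Bₐ σ τ s t) = Bounded N σ × Bounded N τ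
BoundedFormula N (¬ᶠ φ) = BoundedFormula N φ
BoundedFormula N (φ ∧ᶠ ψ) = BoundedFormula N φ × BoundedFormula N ψ
BoundedFormula N (∃ᶠ φ) = BoundedFormula N φ

BoundedFormula-mono : ∀ {P n N N'} (φ : Formula P n) → N ≤ N' → BoundedFormula N φ → BoundedFormula N' φ
BoundedFormula-mono (s ≐ t) N≤N' b = tt
BoundedFormula-mono (Uₐ σ t) N≤N' b = Bounded-mono N≤N' b
BoundedFormula-mono (Bₐ σ τ s t) N≤N' (bσ , bτ) = Bounded-mono N≤N' bσ , Bounded-mono N≤N' bτ
BoundedFormula-mono (¬ᶠ φ) N≤N' b = BoundedFormula-mono φ N≤N' b
BoundedFormula-mono (φ ∧ᶠ ψ) N≤N' (bφ , bψ) = BoundedFormula-mono φ N≤N' bφ , BoundedFormula-mono ψ N≤N' bψ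
BoundedFormula-mono (∃ᶠ φ) N≤N' b = BoundedFormula-mono φ N≤N' b

boundedFormula-exists : ∀ {P n} (φ : Formula P n) → ∃ λ N → BoundedFormula N φ
boundedFormula-exists (s ≐ t) = 0 , tt
boundedFormula-exists (Uₐ σ t) = bounded-exists σ
boundedFormula-exists (Bₐ σ τ s t) with bounded-exists σ | bounded-exists τ
... | N , bσ | N' , bτ = N ⊔ N' , Bounded-mono (m≤m⊔n N N') bσ , Bounded-mono (m≤n⊔m N N') bτ
boundedFormula-exists (¬ᶠ φ) = boundedFormula-exists φ
boundedFormula-exists (φ ∧ᶠ ψ) with boundedFormula-exists φ | boundedFormula-exists ψ
... | N , bφ | N' , bψ =
  N ⊔ N' , BoundedFormula-mono φ (m≤m⊔n N N') bφ , BoundedFormula-mono ψ (m≤n⊔m N N') bψ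
boundedFormula-exists (∃ᶠ φ) = boundedFormula-exists φ

module Consequences (M : L-Structure) (T : IsModelOfT M) where
  open L-Structure M
  open IsModelOfT T

  U-resp : ∀ {m n} {σ : Vec ℕ m} {σ' : Vec ℕ n} → toList σ ≡ toList σ' → ∀ {x} → U σ x → U σ' x
  U-resp {σ = σ} {σ'} e {x} u with toList-length σ σ' e
  ... | refl = subst (λ v → U v x) (toList-injective′ σ σ' e) u

  B-resp : ∀ {m n} {σ τ : Vec ℕ m} {σ' τ' : Vec ℕ n} → toList σ ≡ toList σ' → toList τ ≡ toList τ' →
           ∀ {x y} → B σ τ x y → B σ' τ' x y
  B-resp {σ = σ} {τ} {σ'} {τ'} e e' {x} {y} b with toList-length σ σ' e
  ... | refl = subst₂ (λ v w → B v w x y) (toList-injective′ σ σ' e) (toList-injective′ τ τ' e') b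

  U-prefix : ∀ {m n} (σ : Vec ℕ m) {σ' : Vec ℕ n} (γ : List ℕ) → toList σ' ≡ toList σ L.++ γ →
             ∀ {x} → U σ' x → U σ x
  U-prefix σ γ e {x} u = ax-c σ (fromList γ) x (U-resp (trans e (sym (toList-++-fromList σ γ))) u)

  U-init : ∀ {m} (σ : Vec ℕ m) (j : ℕ) {x} → U (σ ∷ʳ j) x → U σ x
  U-init σ j = U-prefix σ L.[ j ] (toList-∷ʳ j σ)

  U-unique : ∀ {n} (σ τ : Vec ℕ n) {x} → U σ x → U τ x → σ ≡ τ
  U-unique {zero} [] [] _ _ = refl
  U-unique {suc n} σ τ {x} uσ uτ with V.initLast σ | V.initLast τ
  ... | σ₀ , i , refl | τ₀ , j , refl with U-unique σ₀ τ₀ (U-init σ₀ i uσ) (U-init τ₀ j uτ)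
  ... | refl with i ≟ j
  ... | yes refl = refl
  ... | no i≢j = ⊥-elim (ax-d σ₀ i j i≢j x uσ uτ)

  U-prefix-of : ∀ {m n} (σ : Vec ℕ m) (τ : Vec ℕ n) → m ≤ n → ∀ {x} → U σ x → U τ x →
                Σ (List ℕ) λ γ → toList τ ≡ toList σ L.++ γ
  U-prefix-of σ τ m≤n uσ uτ with splitPrefix m≤n τ
  ... | τ₀ , γ , e with U-unique σ τ₀ uσ (U-prefix τ₀ γ e uτ)
  ... | refl = γ , e

  B-extend : ∀ {k n} {σ ρ : Vec ℕ k} {σ' ρ' : Vec ℕ n} (γ : List ℕ) →
             toList σ' ≡ toList σ L.++ γ → toList ρ' ≡ toList ρ L.++ γ →
             ∀ {x y} → B σ ρ x y → U σ' x → B σ' ρ' x y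
  B-extend L.[] e e' b u = B-resp (sym (trans e (LP.++-identityʳ _))) (sym (trans e' (LP.++-identityʳ _))) b
  B-extend {σ = σ} {ρ} {σ'} {ρ'} (j L.∷ γ) e e' {x} {y} b u =
    B-extend γ eσ eρ (proj₂ (ax-h₁ σ ρ j x y (U-prefix (σ ∷ʳ j) γ eσ u) (proj₂ (ax-e-dom σ ρ x y b)) b)) u
    where
      eσ : toList σ' ≡ toList (σ ∷ʳ j) L.++ γ
      eσ = trans e (toList-∷ʳ-++ σ j γ)
      eρ : toList ρ' ≡ toList (ρ ∷ʳ j) L.++ γ
      eρ = trans e' (toList-∷ʳ-++ ρ j γ)

  B-restrict : ∀ {k n} {σ ρ : Vec ℕ k} {σ' ρ' : Vec ℕ n} (γ : List ℕ) →
               toList σ' ≡ toList σ L.++ γ → toList ρ' ≡ toList ρ L.++ γ →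
               ∀ {x y} → B σ' ρ' x y → B σ ρ x y
  B-restrict L.[] e e' b = B-resp (trans e (LP.++-identityʳ _)) (trans e' (LP.++-identityʳ _)) b
  B-restrict {σ = σ} {ρ} (j L.∷ γ) e e' {x} {y} b =
    ax-h₂ σ ρ j x y uσj (U-init ρ j uρj) (uρj , bj)
    where
      bj : B (σ ∷ʳ j) (ρ ∷ʳ j) x y
      bj = B-restrict γ (trans e (toList-∷ʳ-++ σ j γ)) (trans e' (toList-∷ʳ-++ ρ j γ)) b
      uσj : U (σ ∷ʳ j) x
      uσj = proj₁ (ax-e-dom _ _ x y bj)
      uρj : U (ρ ∷ʳ j) y
      uρj = proj₂ (ax-e-dom _ _ x y bj)

  B-diagonal : ∀ {n} (σ : Vec ℕ n) {x y} → B σ σ x y → x ≡ y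
  B-diagonal σ {x} {y} b = sym (ax-e-fun σ σ x y x b (ax-g σ σ σ x y x b (ax-f₁ σ σ x y b)))

  -- When |β| = N no N-bounded string lies strictly below β, and genericity
  -- reduces to membership in U_β.
  Generic : ℕ → ∀ {ℓ} → Vec ℕ ℓ → Carrier → Set
  Generic N {ℓ} β c = U β c × (ℓ ≡ N ⊎ (∀ j → j < N → ¬ U (β ∷ʳ j) c))

module Formulas (M : L-Structure) where
  open L-Structure M
  open Semantics M

  _⊨*_ : ∀ {E : Carrier → Set} → Carrier → List (Formula (Params E) 1) → Set
  a ⊨* ψs = All (λ ψ → a ⊨ ψ) ψs

  termParameters : ∀ {E : Carrier → Set} {n} → Term (Params E) n → List Carrier
  termParameters (var _) = L.[]
  termParameters (par a) = L.[ proj₁ a ]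

  parameters : ∀ {E : Carrier → Set} {n} → Formula (Params E) n → List Carrier
  parameters (s ≐ t) = termParameters s L.++ termParameters t
  parameters (Uₐ σ t) = termParameters t
  parameters (Bₐ σ τ s t) = termParameters s L.++ termParameters t
  parameters (¬ᶠ φ) = parameters φ
  parameters (φ ∧ᶠ ψ) = parameters φ L.++ parameters ψ
  parameters (∃ᶠ φ) = parameters φ

  record IsBoundedSymmetry (N : ℕ) (π : Carrier → Carrier) : Set where
    field
      involutive  : ∀ x → π (π x) ≡ x
      preserves-U : ∀ {k} (σ : Vec ℕ k) → Bounded N σ → ∀ {x} → U σ x → U σ (π x)
      preserves-B : ∀ {k} (σ τ : Vec ℕ k) → Bounded N σ → Bounded N τ →
                    ∀ {x y} → B σ τ x y → B σ τ (π x) (π y)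

  module _ {N : ℕ} {π : Carrier → Carrier} (π-symmetry : IsBoundedSymmetry N π) where
    open IsBoundedSymmetry π-symmetry

    evalT-symmetric : ∀ {E : Carrier → Set} {n} (t : Term (Params E) n) →
                      (∀ b → b ∈ termParameters t → π b ≡ b) →
                      ∀ {ρ ρ'} → (∀ i → ρ' i ≡ π (ρ i)) → evalT ρ' t ≡ π (evalT ρ t)
    evalT-symmetric (var i) fixed ρ'≗πρ = ρ'≗πρ i
    evalT-symmetric (par a) fixed ρ'≗πρ = sym (fixed (proj₁ a) (here refl))

    Sat-symmetric : ∀ {E : Carrier → Set} {n} (φ : Formula (Params E) n) → BoundedFormula N φ →
                    (∀ b → b ∈ parameters φ → π b ≡ b) →
                    ∀ ρ ρ' → (∀ i → ρ' i ≡ π (ρ i)) → Sat φ ρ → Sat φ ρ'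
    Sat-symmetric (s ≐ t) _ fixed ρ ρ' ρ'≗πρ e =
      trans (evalT-symmetric s (λ b m → fixed b (∈-++⁺ˡ m)) ρ'≗πρ)
        (trans (cong π e) (sym (evalT-symmetric t (λ b m → fixed b (∈-++⁺ʳ (termParameters s) m)) ρ'≗πρ)))
    Sat-symmetric (Uₐ σ t) bσ fixed ρ ρ' ρ'≗πρ u =
      subst (U σ) (sym (evalT-symmetric t fixed ρ'≗πρ)) (preserves-U σ bσ u)
    Sat-symmetric (Bₐ σ τ s t) (bσ , bτ) fixed ρ ρ' ρ'≗πρ b =
      subst₂ (B σ τ) (sym (evalT-symmetric s (λ b m → fixed b (∈-++⁺ˡ m)) ρ'≗πρ))
        (sym (evalT-symmetric t (λ b m → fixed b (∈-++⁺ʳ (termParameters s) m)) ρ'≗πρ))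
        (preserves-B σ τ bσ bτ b)
    Sat-symmetric (¬ᶠ φ) bφ fixed ρ ρ' ρ'≗πρ ¬φρ φρ' =
      ¬φρ (Sat-symmetric φ bφ fixed ρ' ρ (λ i → trans (sym (involutive (ρ i))) (cong π (sym (ρ'≗πρ i)))) φρ')
    Sat-symmetric (φ ∧ᶠ ψ) (bφ , bψ) fixed ρ ρ' ρ'≗πρ (φρ , ψρ) =
      Sat-symmetric φ bφ (λ b m → fixed b (∈-++⁺ˡ m)) ρ ρ' ρ'≗πρ φρ ,
      Sat-symmetric ψ bψ (λ b m → fixed b (∈-++⁺ʳ (parameters φ) m)) ρ ρ' ρ'≗πρ ψρ
    Sat-symmetric (∃ᶠ φ) bφ fixed ρ ρ' ρ'≗πρ (a , φaρ) =
      π a , Sat-symmetric φ bφ fixed (extend a ρ) (extend (π a) ρ') (λ { fz → refl ; (fs i) → ρ'≗πρ i }) φaρ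

  module _ {E F : Carrier → Set} (f : Params E → Params F) (f-underlying : ∀ x → proj₁ (f x) ≡ proj₁ x) where
    evalT-mapTerm : ∀ {n} (t : Term (Params E) n) ρ → evalT ρ (mapTerm f t) ≡ evalT ρ t
    evalT-mapTerm (var i) ρ = refl
    evalT-mapTerm (par a) ρ = f-underlying a

    Sat-mapFormula : ∀ {n} (φ : Formula (Params E) n) ρ →
                     (Sat (mapFormula f φ) ρ → Sat φ ρ) × (Sat φ ρ → Sat (mapFormula f φ) ρ)
    Sat-mapFormula (s ≐ t) ρ =
      (λ e → trans (sym (evalT-mapTerm s ρ)) (trans e (evalT-mapTerm t ρ))) ,
      (λ e → trans (evalT-mapTerm s ρ) (trans e (sym (evalT-mapTerm t ρ))))
    Sat-mapFormula (Uₐ σ t) ρ =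
      subst (U σ) (evalT-mapTerm t ρ) , subst (U σ) (sym (evalT-mapTerm t ρ))
    Sat-mapFormula (Bₐ σ τ s t) ρ =
      subst₂ (B σ τ) (evalT-mapTerm s ρ) (evalT-mapTerm t ρ) ,
      subst₂ (B σ τ) (sym (evalT-mapTerm s ρ)) (sym (evalT-mapTerm t ρ))
    Sat-mapFormula (¬ᶠ φ) ρ =
      (λ ¬fφ φρ → ¬fφ (proj₂ (Sat-mapFormula φ ρ) φρ)) ,
      (λ ¬φρ fφ → ¬φρ (proj₁ (Sat-mapFormula φ ρ) fφ))
    Sat-mapFormula (φ ∧ᶠ ψ) ρ =
      (λ { (fφ , fψ) → proj₁ (Sat-mapFormula φ ρ) fφ , proj₁ (Sat-mapFormula ψ ρ) fψ }) ,
      (λ { (φρ , ψρ) → proj₂ (Sat-mapFormula φ ρ) φρ , proj₂ (Sat-mapFormula ψ ρ) ψρ })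
    Sat-mapFormula (∃ᶠ φ) ρ =
      (λ { (a , s) → a , proj₁ (Sat-mapFormula φ (extend a ρ)) s }) ,
      (λ { (a , s) → a , proj₂ (Sat-mapFormula φ (extend a ρ)) s })

  ⋀ : ∀ {E : Carrier → Set} → List (Formula (Params E) 1) → Formula (Params E) 1
  ⋀ L.[] = var fz ≐ var fz
  ⋀ (ψ L.∷ ψs) = ψ ∧ᶠ ⋀ ψs

  ⋀-⊨⁻ : ∀ {E : Carrier → Set} {a} (ψs : List (Formula (Params E) 1)) → a ⊨ ⋀ ψs → a ⊨* ψs
  ⋀-⊨⁻ L.[] _ = All.[]
  ⋀-⊨⁻ (ψ L.∷ ψs) (aψ , aψs) = aψ All.∷ ⋀-⊨⁻ ψs aψs

  ⋀-⊨⁺ : ∀ {E : Carrier → Set} {a} {ψs : List (Formula (Params E) 1)} → a ⊨* ψs → a ⊨ ⋀ ψs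
  ⋀-⊨⁺ All.[] = refl
  ⋀-⊨⁺ (aψ All.∷ aψs) = aψ , ⋀-⊨⁺ aψs

module CompleteTypes (M : L-Structure) where
  open L-Structure M
  open Semantics M
  open Formulas M

  module _ {E : Carrier → Set} {t : TypeOver E} (t-complete : IsCompleteType E t) where
    ∈-by-implication : ∀ ψs → All t ψs → ∀ φ → (∀ a → a ⊨* ψs → a ⊨ φ) → t φ
    ∈-by-implication ψs tψs φ ψs⇒φ with proj₂ t-complete φ
    ... | inj₁ tφ = tφ
    ... | inj₂ t¬φ with proj₁ t-complete (¬ᶠ φ L.∷ ψs) (t¬φ All.∷ tψs)
    ... | a , ¬φa All.∷ aψs = ⊥-elim (¬φa (ψs⇒φ a aψs))

    algebraic-by-finite-realisations : ∀ ψs → All t ψs → ∀ F → (∀ a → a ⊨* ψs → a ∈ F) → IsAlgebraic t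
    algebraic-by-finite-realisations ψs tψs F ψs⊆F =
      ⋀ ψs , ∈-by-implication ψs tψs (⋀ ψs) (λ _ → ⋀-⊨⁺) , F , λ a aψs → ψs⊆F a (⋀-⊨⁻ ψs aψs)

    realisation-avoiding : ExcludedMiddle 0ℓ → NonAlgebraic t →
                           ∀ ψs → All t ψs → ∀ F → ∃ λ a → a ⊨* ψs × ¬ a ∈ F
    realisation-avoiding em t-nonAlgebraic ψs tψs F with em {∃ λ a → a ⊨* ψs × ¬ a ∈ F}
    ... | yes found = found
    ... | no none = ⊥-elim (t-nonAlgebraic (algebraic-by-finite-realisations ψs tψs F ψs⊆F))
      where
        ψs⊆F : ∀ a → a ⊨* ψs → a ∈ F
        ψs⊆F a aψs with em {a ∈ F}
        ... | yes a∈F = a∈F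
        ... | no a∉F = ⊥-elim (none (a , aψs , a∉F))

module Orbits (M : L-Structure) (T : IsModelOfT M) (N : ℕ) {ℓ : ℕ} (β : Vec ℕ ℓ) where
  open L-Structure M
  open IsModelOfT T
  open Semantics M
  open Consequences M T
  open Formulas M

  module Orbit {c : Carrier} (c-generic : Generic N β c) where
    orbit : Vec ℕ ℓ → Carrier
    orbit τ = proj₁ (ax-e-tot β τ c (proj₁ c-generic))

    B-orbit : ∀ τ → B β τ c (orbit τ)
    B-orbit τ = proj₂ (ax-e-tot β τ c (proj₁ c-generic))

    U-orbit : ∀ τ → U τ (orbit τ)
    U-orbit τ = proj₂ (ax-e-dom β τ c (orbit τ) (B-orbit τ))

    orbit-β : orbit β ≡ c
    orbit-β = sym (B-diagonal β (B-orbit β))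

    orbit-injective : ∀ {τ υ} → orbit τ ≡ orbit υ → τ ≡ υ
    orbit-injective {τ} {υ} e = U-unique τ υ (U-orbit τ) (subst (U υ) (sym e) (U-orbit υ))

    B-orbit-orbit : ∀ τ υ → B τ υ (orbit τ) (orbit υ)
    B-orbit-orbit τ υ = ax-g τ β υ (orbit τ) c (orbit υ) (ax-f₁ β τ c (orbit τ) (B-orbit τ)) (B-orbit υ)

    orbit-generic : ℓ < N → ∀ τ j → j < N → ¬ U (τ ∷ʳ j) (orbit τ)
    orbit-generic ℓ<N τ j j<N uτj with proj₂ c-generic
    ... | inj₁ refl = <-irrefl refl ℓ<N
    ... | inj₂ βj∌c =
      βj∌c j j<N (proj₁ (ax-h₁ τ β j (orbit τ) c uτj (proj₁ c-generic) (ax-f₁ β τ c (orbit τ) (B-orbit τ))))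

    U-orbit⇒prefix : ∀ {m} (ρ : Vec ℕ m) → Bounded N ρ → ∀ τ → U ρ (orbit τ) →
                     Σ (List ℕ) λ γ → toList τ ≡ toList ρ L.++ γ
    U-orbit⇒prefix {m} ρ (m≤N , ρ<N) τ u with m ≤? ℓ
    ... | yes m≤ℓ = U-prefix-of ρ τ m≤ℓ u (U-orbit τ)
    ... | no m≰ℓ with U-prefix-of τ ρ (<⇒≤ (≰⇒> m≰ℓ)) (U-orbit τ) u
    ... | L.[] , e = ⊥-elim (m≰ℓ (≤-reflexive (toList-length ρ τ (trans e (LP.++-identityʳ _)))))
    ... | j L.∷ γ , e =
      ⊥-elim (orbit-generic (<-≤-trans (≰⇒> m≰ℓ) m≤N) τ j j<N
                (U-prefix (τ ∷ʳ j) γ (trans e (toList-∷ʳ-++ τ j γ)) u))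
      where
        j<N : j < N
        j<N = All.head (AllP.++⁻ʳ (toList τ) (subst (All (_< N)) e ρ<N))

    B-orbit⇒ : ∀ {k} (σ ρ : Vec ℕ k) → Bounded N σ → ∀ τ {z} → B σ ρ (orbit τ) z →
               Σ (Vec ℕ ℓ) λ υ → z ≡ orbit υ × SameTail σ ρ τ υ
    B-orbit⇒ σ ρ bσ τ {z} b with U-orbit⇒prefix σ bσ τ (proj₁ (ax-e-dom σ ρ _ _ b))
    ... | γ , e with fromList-ofLength (toList ρ L.++ γ) ργ-length
      where
        open ≡-Reasoning
        ργ-length : L.length (toList ρ L.++ γ) ≡ ℓ
        ργ-length = begin
          L.length (toList ρ L.++ γ)          ≡⟨ LP.length-++ (toList ρ) ⟩
          L.length (toList ρ) + L.length γ    ≡⟨ cong (_+ L.length γ) (trans (length-toList ρ) (sym (length-toList σ))) ⟩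
          L.length (toList σ) + L.length γ    ≡⟨ LP.length-++ (toList σ) ⟨
          L.length (toList σ L.++ γ)          ≡⟨ cong L.length e ⟨
          L.length (toList τ)                 ≡⟨ length-toList τ ⟩
          ℓ                                   ∎
    ... | υ , eυ = υ , z≡orbitυ , γ , e , eυ
      where
        B-τυ : B τ υ (orbit τ) z
        B-τυ = B-extend γ e eυ b (U-orbit τ)
        z≡orbitυ : z ≡ orbit υ
        z≡orbitυ = ax-e-fun β υ c z (orbit υ) (ax-g β τ υ c (orbit τ) z (B-orbit τ) B-τυ) (B-orbit υ)

    SameTail⇒B-orbit : ∀ {k} (σ ρ : Vec ℕ k) τ υ → SameTail σ ρ τ υ → B σ ρ (orbit τ) (orbit υ)
    SameTail⇒B-orbit σ ρ τ υ (γ , e , eυ) = B-restrict γ e eυ (B-orbit-orbit τ υ)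

  module Swap (em : ExcludedMiddle 0ℓ) {a a' : Carrier} (a-generic : Generic N β a)
              (a'-generic : Generic N β a') (a≢a' : a ≢ a') where
    module O = Orbit a-generic
    module O' = Orbit a'-generic

    orbits-disjoint : ∀ {τ υ} → O.orbit τ ≢ O'.orbit υ
    orbits-disjoint {τ} {υ} e with U-unique τ υ (O.U-orbit τ) (subst (U υ) (sym e) (O'.U-orbit υ))
    ... | refl = a≢a' (ax-e-inj β τ a a' (O'.orbit τ) (subst (B β τ a) e (O.B-orbit τ)) (O'.B-orbit τ))

    data Position (y : Carrier) : Set where
      in-orbit  : ∀ τ → y ≡ O.orbit τ → Position y
      in-orbit' : ∀ τ → y ≡ O'.orbit τ → Position y
      outside   : (∀ τ → y ≢ O.orbit τ) → (∀ τ → y ≢ O'.orbit τ) → Position y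

    position : ∀ y → Position y
    position y with em {∃ λ τ → y ≡ O.orbit τ} | em {∃ λ τ → y ≡ O'.orbit τ}
    ... | yes (τ , e) | _ = in-orbit τ e
    ... | no _ | yes (τ , e) = in-orbit' τ e
    ... | no ∉O | no ∉O' = outside (λ τ e → ∉O (τ , e)) (λ τ e → ∉O' (τ , e))

    swapAt : ∀ {y} → Position y → Carrier
    swapAt (in-orbit τ _) = O'.orbit τ
    swapAt (in-orbit' τ _) = O.orbit τ
    swapAt {y} (outside _ _) = y

    π : Carrier → Carrier
    π y = swapAt (position y)

    π-orbit : ∀ τ → π (O.orbit τ) ≡ O'.orbit τ
    π-orbit τ = go (position (O.orbit τ))
      where
        go : (c : Position (O.orbit τ)) → swapAt c ≡ O'.orbit τ
        go (in-orbit υ e) = cong O'.orbit (sym (O.orbit-injective e))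
        go (in-orbit' υ e) = ⊥-elim (orbits-disjoint e)
        go (outside ∉O _) = ⊥-elim (∉O τ refl)

    π-orbit' : ∀ τ → π (O'.orbit τ) ≡ O.orbit τ
    π-orbit' τ = go (position (O'.orbit τ))
      where
        go : (c : Position (O'.orbit τ)) → swapAt c ≡ O.orbit τ
        go (in-orbit υ e) = ⊥-elim (orbits-disjoint (sym e))
        go (in-orbit' υ e) = cong O.orbit (sym (O'.orbit-injective e))
        go (outside _ ∉O') = ⊥-elim (∉O' τ refl)

    π-outside : ∀ y → (∀ τ → y ≢ O.orbit τ) → (∀ τ → y ≢ O'.orbit τ) → π y ≡ y
    π-outside y ∉O ∉O' = go (position y)
      where
        go : (c : Position y) → swapAt c ≡ y
        go (in-orbit τ e) = ⊥-elim (∉O τ e)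
        go (in-orbit' τ e) = ⊥-elim (∉O' τ e)
        go (outside _ _) = refl

    π-involutive : ∀ y → π (π y) ≡ y
    π-involutive y = go (position y)
      where
        go : (c : Position y) → π (swapAt c) ≡ y
        go (in-orbit τ refl) = π-orbit' τ
        go (in-orbit' τ refl) = π-orbit τ
        go (outside ∉O ∉O') = π-outside y ∉O ∉O'

    π-preserves-U : ∀ {k} (σ : Vec ℕ k) → Bounded N σ → ∀ {y} → U σ y → U σ (π y)
    π-preserves-U σ bσ {y} = go (position y)
      where
        go : (c : Position y) → U σ y → U σ (swapAt c)
        go (in-orbit τ refl) u with O.U-orbit⇒prefix σ bσ τ u
        ... | γ , e = U-prefix σ γ e (O'.U-orbit τ)
        go (in-orbit' τ refl) u with O'.U-orbit⇒prefix σ bσ τ u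
        ... | γ , e = U-prefix σ γ e (O.U-orbit τ)
        go (outside _ _) u = u

    B-outside : ∀ {k} (σ ρ : Vec ℕ k) → Bounded N ρ → ∀ {y z} →
                (∀ τ → y ≢ O.orbit τ) → (∀ τ → y ≢ O'.orbit τ) → B σ ρ y z → π z ≡ z
    B-outside σ ρ bρ {y} {z} ∉O ∉O' b = π-outside z z∉O z∉O'
      where
        zBy : B ρ σ z y
        zBy = ax-f₁ σ ρ y z b
        z∉O : ∀ υ → z ≢ O.orbit υ
        z∉O υ refl with O.B-orbit⇒ ρ σ bρ υ zBy
        ... | τ , y≡ , _ = ∉O τ y≡
        z∉O' : ∀ υ → z ≢ O'.orbit υ
        z∉O' υ refl with O'.B-orbit⇒ ρ σ bρ υ zBy
        ... | τ , y≡ , _ = ∉O' τ y≡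

    π-preserves-B : ∀ {k} (σ ρ : Vec ℕ k) → Bounded N σ → Bounded N ρ →
                    ∀ {y z} → B σ ρ y z → B σ ρ (π y) (π z)
    π-preserves-B σ ρ bσ bρ {y} {z} = go (position y)
      where
        go : (c : Position y) → B σ ρ y z → B σ ρ (swapAt c) (π z)
        go (in-orbit τ refl) b with O.B-orbit⇒ σ ρ bσ τ b
        ... | υ , refl , tail = subst (B σ ρ (O'.orbit τ)) (sym (π-orbit υ)) (O'.SameTail⇒B-orbit σ ρ τ υ tail)
        go (in-orbit' τ refl) b with O'.B-orbit⇒ σ ρ bσ τ b
        ... | υ , refl , tail = subst (B σ ρ (O.orbit τ)) (sym (π-orbit' υ)) (O.SameTail⇒B-orbit σ ρ τ υ tail)
        go (outside ∉O ∉O') b = subst (B σ ρ y) (sym (B-outside σ ρ bρ ∉O ∉O' b)) b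

    π-isBoundedSymmetry : IsBoundedSymmetry N π
    π-isBoundedSymmetry = record
      { involutive = π-involutive
      ; preserves-U = π-preserves-U
      ; preserves-B = π-preserves-B
      }

  module _ (em : ExcludedMiddle 0ℓ) where
    -- the point of U_β in the orbit of b, if b lies in some U_τ with |τ| = |β|
    representativeFrom : ∀ b → Dec (∃ λ (τ : Vec ℕ ℓ) → U τ b) → List Carrier
    representativeFrom b (yes (τ , u)) = L.[ proj₁ (ax-e-tot τ β b u) ]
    representativeFrom b (no _) = L.[]

    representatives : List Carrier → List Carrier
    representatives = L.concatMap (λ b → representativeFrom b em)

    orbit⇒representative : ∀ {c} (c-generic : Generic N β c) τ →
                           c ∈ representativeFrom (Orbit.orbit c-generic τ) em
    orbit⇒representative {c} c-generic τ = go em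
      where
        open Orbit c-generic
        go : (d : Dec (∃ λ (τ' : Vec ℕ ℓ) → U τ' (orbit τ))) → c ∈ representativeFrom (orbit τ) d
        go (yes (τ' , u)) with U-unique τ' τ u (U-orbit τ)
        ... | refl = here (sym (ax-e-fun τ β (orbit τ) _ c (proj₂ (ax-e-tot τ β (orbit τ) u))
                                         (ax-f₁ β τ c (orbit τ) (B-orbit τ))))
        go (no ∄τ) = ⊥-elim (∄τ (τ , U-orbit τ))

    parameters-outside-orbit : ∀ {E : Carrier → Set} (φ : Formula (Params E) 1) {c} (c-generic : Generic N β c) →
                               ¬ c ∈ representatives (parameters φ) →
                               ∀ b → b ∈ parameters φ → ∀ τ → b ≢ Orbit.orbit c-generic τ
    parameters-outside-orbit φ c-generic c∉ b b∈ τ refl =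
      c∉ (∈-concatMap⁺ _ (lose b∈ (orbit⇒representative c-generic τ)))

    generic-transfer : ∀ {E : Carrier → Set} (φ : Formula (Params E) 1) → BoundedFormula N φ →
                       ∀ {a₀ a} (a₀-generic : Generic N β a₀) (a-generic : Generic N β a) →
                       ¬ a₀ ∈ representatives (parameters φ) → ¬ a ∈ representatives (parameters φ) →
                       a₀ ⊨ φ → a ⊨ φ
    generic-transfer φ bφ {a₀} {a} a₀-generic a-generic a₀∉ a∉ with em {a₀ ≡ a}
    ... | yes refl = λ φa₀ → φa₀
    ... | no a₀≢a = Sat-symmetric π-isBoundedSymmetry φ bφ fixed (λ _ → a₀) (λ _ → a) (λ _ → sym πa₀≡a)
      where
        open Swap em a₀-generic a-generic a₀≢a
        fixed : ∀ b → b ∈ parameters φ → π b ≡ b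
        fixed b b∈ = π-outside b (parameters-outside-orbit φ a₀-generic a₀∉ b b∈)
                                 (parameters-outside-orbit φ a-generic a∉ b b∈)
        πa₀≡a : π a₀ ≡ a
        πa₀≡a = trans (cong π (sym O.orbit-β)) (trans (π-orbit β) O'.orbit-β)

module NonAlgebraicExtension
  (em : ExcludedMiddle 0ℓ) (M : L-Structure) (T : IsModelOfT M)
  (A D : L-Structure.Carrier M → Set) (A⊆D : ∀ x → A x → D x)
  (p : Semantics.TypeOver M A) (p-complete : Semantics.IsCompleteType M A p)
  (p-nonAlgebraic : Semantics.NonAlgebraic M p) where
  open L-Structure M
  open IsModelOfT T
  open Semantics M
  open Consequences M T
  open Formulas M
  open CompleteTypes M

  FormulaA : Set
  FormulaA = Formula (Params A) 1

  embed : Params A → Params D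
  embed (a , a∈A) = a , A⊆D a a∈A

  q : TypeOver D
  q φ = Σ (List FormulaA) λ ψs → All p ψs × Σ (List Carrier) λ F → ∀ a → a ⊨* ψs → ¬ a ∈ F → a ⊨ φ

  record GenericPart (N : ℕ) : Set where
    field
      {level}           : ℕ
      node              : Vec ℕ level
      formulas          : List FormulaA
      formulas∈p        : All p formulas
      realisers-generic : ∀ a → a ⊨* formulas → Generic N node a

  descend : ∀ N m {k} (β : Vec ℕ k) → k + m ≡ N → p (Uₐ β (var fz)) → GenericPart N
  descend N zero {k} β k+0≡N pβ = record
    { node = β
    ; formulas = L.[ Uₐ β (var fz) ]
    ; formulas∈p = pβ All.∷ All.[]
    ; realisers-generic = λ { a (u All.∷ All.[]) → u , inj₁ (trans (sym (+-identityʳ k)) k+0≡N) }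
    }
  descend N (suc m) {k} β k+m+1≡N pβ with em {∃ λ j → j < N × p (Uₐ (β ∷ʳ j) (var fz))}
  ... | yes (j , _ , pβj) = descend N m (β ∷ʳ j) (trans (sym (+-suc k m)) k+m+1≡N) pβj
  ... | no no-child = record
    { node = β
    ; formulas = Uₐ β (var fz) L.∷ children-excluded
    ; formulas∈p = pβ All.∷ AllP.map⁺ (All.tabulate (λ j∈ → p-excludes-child (∈-upTo⁻ j∈)))
    ; realisers-generic = λ { a (u All.∷ excluded) →
        u , inj₂ (λ j j<N → All.lookup (AllP.map⁻ excluded) (∈-upTo⁺ j<N)) }
    }
    where
      children-excluded : List FormulaA
      children-excluded = L.map (λ j → ¬ᶠ Uₐ (β ∷ʳ j) (var fz)) (L.upTo N)
      p-excludes-child : ∀ {j} → j < N → p (¬ᶠ Uₐ (β ∷ʳ j) (var fz))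
      p-excludes-child {j} j<N with proj₂ p-complete (Uₐ (β ∷ʳ j) (var fz))
      ... | inj₁ pβj = ⊥-elim (no-child (j , j<N , pβj))
      ... | inj₂ p¬βj = p¬βj

  genericPart : ∀ N → GenericPart N
  genericPart N = descend N N [] refl (∈-by-implication p-complete L.[] All.[] (Uₐ [] (var fz)) (λ a _ → ax-a a))

  q-decides-at : ∀ {N} → GenericPart N → ∀ φ → BoundedFormula N φ → q φ ⊎ q (¬ᶠ φ)
  q-decides-at {N} G φ bφ = decide em
    where
      open GenericPart G
      open Orbits M T N node using (representatives; generic-transfer)
      F : List Carrier
      F = representatives em (parameters φ)
      decide : Dec (∃ λ a₀ → a₀ ⊨* formulas × ¬ a₀ ∈ F × a₀ ⊨ φ) → q φ ⊎ q (¬ᶠ φ)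
      decide (yes (a₀ , a₀-formulas , a₀∉F , φa₀)) = inj₁ (formulas , formulas∈p , F , λ a a-formulas a∉F →
        generic-transfer em φ bφ (realisers-generic a₀ a₀-formulas) (realisers-generic a a-formulas) a₀∉F a∉F φa₀)
      decide (no none) = inj₂ (formulas , formulas∈p , F , λ a a-formulas a∉F φa → none (a , a-formulas , a∉F , φa))

  q-decides : ∀ φ → q φ ⊎ q (¬ᶠ φ)
  q-decides φ = let N , bφ = boundedFormula-exists φ in q-decides-at (genericPart N) φ bφ

  q-combine : ∀ φs → All q φs →
              Σ (List FormulaA) λ ψs → All p ψs × Σ (List Carrier) λ F → ∀ a → a ⊨* ψs → ¬ a ∈ F → a ⊨* φs
  q-combine L.[] All.[] = L.[] , All.[] , L.[] , λ _ _ _ → All.[]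
  q-combine (φ L.∷ φs) ((ψs , ψs∈p , F , forces) All.∷ qφs) with q-combine φs qφs
  ... | ψs' , ψs'∈p , F' , forces' =
    ψs L.++ ψs' , AllP.++⁺ ψs∈p ψs'∈p , F L.++ F' , λ a aψs a∉ →
      forces a (AllP.++⁻ˡ ψs aψs) (λ a∈F → a∉ (∈-++⁺ˡ a∈F)) All.∷
      forces' a (AllP.++⁻ʳ ψs aψs) (λ a∈F' → a∉ (∈-++⁺ʳ F a∈F'))

  q-complete : IsCompleteType D q
  q-complete = finitely-satisfiable , q-decides
    where
      finitely-satisfiable : ∀ φs → All q φs → ∃ λ a → a ⊨* φs
      finitely-satisfiable φs qφs with q-combine φs qφs
      ... | ψs , ψs∈p , F , forces with realisation-avoiding p-complete em p-nonAlgebraic ψs ψs∈p F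
      ... | a , aψs , a∉F = a , forces a aψs a∉F

  q-nonAlgebraic : NonAlgebraic q
  q-nonAlgebraic (φ , (ψs , ψs∈p , F , forces) , xs , φ⊆xs) =
    p-nonAlgebraic (algebraic-by-finite-realisations p-complete ψs ψs∈p (F L.++ xs) ψs⊆F++xs)
    where
      ψs⊆F++xs : ∀ a → a ⊨* ψs → a ∈ F L.++ xs
      ψs⊆F++xs a aψs with em {a ∈ F}
      ... | yes a∈F = ∈-++⁺ˡ a∈F
      ... | no a∉F = ∈-++⁺ʳ F (φ⊆xs a (forces a aψs a∉F))

  q-extends : Extends A⊆D p q
  q-extends φ pφ = L.[ φ ] , pφ All.∷ All.[] , L.[] ,
    λ { a (φa All.∷ All.[]) _ → proj₂ (Sat-mapFormula embed (λ _ → refl) φ (λ _ → a)) φa }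

  module _ {q' : TypeOver D} (q'-complete : IsCompleteType D q') (q'-nonAlgebraic : NonAlgebraic q')
           (q'-extends : Extends A⊆D p q') where
    q⊆q' : ∀ φ → q φ → q' φ
    q⊆q' φ (ψs , ψs∈p , F , forces) with proj₂ q'-complete φ
    ... | inj₁ q'φ = q'φ
    ... | inj₂ q'¬φ
      with realisation-avoiding q'-complete em q'-nonAlgebraic
             (¬ᶠ φ L.∷ L.map (mapFormula embed) ψs) (q'¬φ All.∷ AllP.map⁺ (All.map (q'-extends _) ψs∈p)) F
    ... | a , ¬φa All.∷ aψs , a∉F =
      ⊥-elim (¬φa (forces a aψs' a∉F))
      where
        aψs' : a ⊨* ψs
        aψs' = All.map (λ {ψ} → proj₁ (Sat-mapFormula embed (λ _ → refl) ψ (λ _ → a))) (AllP.map⁻ aψs)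

    q-unique : SameType q q'
    q-unique φ = q⊆q' φ , q'⊆q
      where
        q'⊆q : q' φ → q φ
        q'⊆q q'φ with q-decides φ
        ... | inj₁ qφ = qφ
        ... | inj₂ q¬φ
          with proj₁ q'-complete (φ L.∷ ¬ᶠ φ L.∷ L.[]) (q'φ All.∷ q⊆q' (¬ᶠ φ) q¬φ All.∷ All.[])
        ... | a , φa All.∷ ¬φa All.∷ All.[] = ⊥-elim (¬φa φa)

proposition3p2 : ExcludedMiddle 0ℓ →
    (M : L-Structure) → IsModelOfT M →
    let open L-Structure M
        open Semantics M
    in (A B : Carrier → Set) → (A⊆B : ∀ x → A x → B x) →
       (p : TypeOver A) → IsCompleteType A p → NonAlgebraic p →
       ∃ λ (q : TypeOver B) →
         (IsCompleteType B q × NonAlgebraic q × Extends A⊆B p q)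
         × (∀ (q' : TypeOver B) → IsCompleteType B q' → NonAlgebraic q' →
              Extends A⊆B p q' → SameType q q')
proposition3p2 em M T A B A⊆B p p-complete p-nonAlgebraic =
  q , (q-complete , q-nonAlgebraic , q-extends) , λ q' → q-unique
  where open NonAlgebraicExtension em M T A B A⊆B p p-complete p-nonAlgebraic
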